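{- Let $\Gamma_4^3$ be the set of cyclically ordered triples $(ijk)$ of distinct elements of $[4]$ (so $(ijk)=(jki)=(kij)$), and let $\Gamma_4^2$ be the set of unordered pairs $(ij)=(ji)$ of distinct elements of $[4]$. For each $\alpha\in\Gamma_4^2$ let $\pi_\alpha:\Gamma_4^3\to\Gamma_4^3$ be the permutation determined by the rules: for all distinct $i,j,k,l\in[4]$, \[ \pi_{(ij)}(ijk)=(jil),\qquad \pi_{(kl)}(ijk)=(ijl). \] Let $G$ be the permutation group of $\Gamma_4^3$ generated by all $\pi_\alpha$. For $\gamma=(ijk)\in\Gamma_4^3$ with $\{l\}=[4]\setminus\{i,j,k\}$, define $o_\gamma:\binom{[4]}{3}\to\Gamma_4^3$ by $o_\gamma(\{i,j,k\})=(ijk)$, $o_\gamma(\{i,j,l\})=(ijl)$, $o_\gamma(\{j,k,l\})=(jkl)$, $o_\gamma(\{k,i,l\})=(kil)$. Then: (1) every element of $G$ is an involution, and $G$ is abelian and acts transitively on $\Gamma_4^3$; (2) for $l\in[4]$, let $H_l$ be the subgroup of $G$ generated by $\pi_{(il)}$ for all $i\in[4]\setminus\{l\}$; for distinct $i,j,k\in[4]\setminus\{l\}$, let $\Gamma_4^3(ijk)$ be the set of all $\gamma\in\Gamma_4^3$ with $o_\gamma(\{i,j,k\})=(ijk)$. Then $\Gamma_4^3(ijk)$ is an orbit of $H_l$. -}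

module Defs where

open import Data.Bool using (T?; Bool; true; false; if_then_else_; _∧_; _∨_; not; T)
open import Data.Fin using (Fin; zero; suc; _≟_)
open import Data.Product using (_×_; _,_)
open import Data.Sum using (_⊎_)
open import Data.List using (List; []; _∷_; allFin; cartesianProduct; filter; map)
open import Relation.Nullary.Decidable using (⌊_⌋)
open import Relation.Binary.PropositionalEquality using (_≡_; _≢_)

Triple : Set
Triple = Fin 4 × Fin 4 × Fin 4

Distinct : Triple → Set
Distinct (i , j , k) = i ≢ j × j ≢ k × k ≢ i

-- Γ₄³ : cyclically ordered triples, i.e. distinct triples modulo the
-- cyclic rotation (ijk) = (jki) = (kij).  We work with representatives
-- and the following equivalence relation.
_≈_ : Triple → Triple → Set
(i , j , k) ≈ t = (t ≡ (i , j , k)) ⊎ ((t ≡ (j , k , i)) ⊎ (t ≡ (k , i , j)))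

_==_ : Fin 4 → Fin 4 → Bool
x == y = ⌊ x ≟ y ⌋

eqT : Triple → Triple → Bool
eqT (a , b , c) (d , e , f) = (a == d) ∧ ((b == e) ∧ (c == f))

cycEq : Triple → Triple → Bool
cycEq (i , j , k) t = eqT t (i , j , k) ∨ (eqT t (j , k , i) ∨ eqT t (k , i , j))

mem : Fin 4 → Triple → Bool
mem x (a , b , c) = (x == a) ∨ ((x == b) ∨ (x == c))

sameSet : Triple → Triple → Bool
sameSet (a , b , c) t = mem a t ∧ (mem b t ∧ mem c t)

rest : Triple → Fin 4
rest t = if not (mem zero t) then zero
         else if not (mem (suc zero) t) then suc zero
         else if not (mem (suc (suc zero)) t) then suc (suc zero)
         else suc (suc (suc zero))

samePair : Fin 4 → Fin 4 → Fin 4 → Fin 4 → Bool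
samePair p q x y = ((p == x) ∧ (q == y)) ∨ ((p == y) ∧ (q == x))

-- π_(pq) : for the representative (i , j , k) with l = rest (i , j , k),
--   π_(ij)(ijk) = (jil)   (and rotations: π_(jk)(jki) = (kjl),
--                                         π_(ki)(kij) = (ikl))
--   π_(kl)(ijk) = (ijl)   (and rotations: π_(il)(jki) = (jkl),
--                                         π_(jl)(kij) = (kil))
-- Every unordered pair of distinct elements falls in exactly one case.

π : Fin 4 → Fin 4 → Triple → Triple
π p q (i , j , k) =
  let l = rest (i , j , k) in
  if samePair p q i j then (j , i , l)
  else if samePair p q j k then (k , j , l)
  else if samePair p q k i then (i , k , l)
  else if samePair p q k l then (i , j , l)
  else if samePair p q i l then (j , k , l)
  else (k , i , l)

allTriples : List Triple
allTriples =
  filter (λ t → T? (isDistinct t))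
    (cartesianProduct (allFin 4) (cartesianProduct (allFin 4) (allFin 4)))
  where
  isDistinct : Triple → Bool
  isDistinct (a , b , c) = not (a == b) ∧ (not (b == c) ∧ not (c == a))

finv : (Triple → Triple) → Triple → Triple
finv f γ = go allTriples
  where
  go : List Triple → Triple
  go [] = γ
  go (δ ∷ ds) = if cycEq (f δ) γ then δ else go ds

-- Subgroups of Sym(Γ₄³) generated by a family of π_(pq):
-- formal words in the generators, closed under identity, composition
-- and inverses, together with their interpretation as permutations.

data Word (Gen : Fin 4 → Fin 4 → Set) : Set where
  gen  : (p q : Fin 4) → Gen p q → Word Gen
  idw  : Word Gen
  _·_  : Word Gen → Word Gen → Word Gen
  inv  : Word Gen → Word Gen

⟦_⟧ : ∀ {Gen} → Word Gen → Triple → Triple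
⟦ gen p q _ ⟧ t = π p q t
⟦ idw ⟧ t = t
⟦ w · v ⟧ t = ⟦ w ⟧ (⟦ v ⟧ t)
⟦ inv w ⟧ t = finv ⟦ w ⟧ t

GenG : Fin 4 → Fin 4 → Set
GenG p q = p ≢ q

GenH : Fin 4 → Fin 4 → Fin 4 → Set
GenH l p q = p ≢ l × q ≡ l

-- o_γ : (3-subsets of [4]) → Γ₄³, for γ = (i , j , k), l = rest γ:
--   {i,j,k} ↦ (ijk), {i,j,l} ↦ (ijl), {j,k,l} ↦ (jkl), {k,i,l} ↦ (kil).
-- A 3-subset is given by any triple listing its elements.

o : Triple → Triple → Triple
o (i , j , k) s =
  let l = rest (i , j , k) in
  if sameSet s (i , j , k) then (i , j , k)
  else if sameSet s (i , j , l) then (i , j , l)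
  else if sameSet s (j , k , l) then (j , k , l)
  else (k , i , l)

-- Each π_(pq) is an involution of Γ₄³ commuting with every π_(rs), and respects the cyclic
-- identification; like every statement about the finitely many triples, this is checked by
-- evaluation.  Induction over words then shows that every element of a group generated by
-- some of the π_(pq) is such a central involution, which gives (1) apart from transitivity.
-- Transitivity and (2) are again finite: the products of π_(01), π_(02), π_(12) carry (012)
-- to every triple, the products of the π_(pl) carry (ijk) onto all of Γ₄³(ijk), and
-- Γ₄³(ijk) is invariant under each π_(pl).
module Submission where

open import Defs
open import Data.Bool using (Bool; true; false; T; if_then_else_)
open import Data.Fin using (Fin; zero; suc; _≟_; punchIn)
open import Data.Fin.Properties using (all?; punchInᵢ≢i)
open import Data.List using (List; []; _∷_; _++_; map; allFin)
open import Data.List.Membership.Propositional using (_∈_)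
open import Data.List.Relation.Unary.All as All using (All)
open import Data.List.Relation.Unary.Any as Any using (Any; here; there)
open import Data.Product using (_×_; _,_; ∃; proj₁; proj₂)
open import Data.Product.Properties using (≡-dec)
open import Data.Sum using (inj₁; inj₂)
open import Function using (_∘_)
open import Function.Bundles using (_⇔_; mk⇔)
open import Relation.Binary.Bundles using (Setoid)
open import Relation.Binary.Definitions using (DecidableEquality; _Respects_)
open import Relation.Binary.PropositionalEquality using (_≡_; _≢_; refl; sym; subst)
open import Relation.Nullary using (Dec)
open import Relation.Nullary.Decidable
  using (map′; ¬?; _×-dec_; _⊎-dec_; _→-dec_; T?; from-yes)
open import Relation.Unary using (Decidable)

rotate : Triple → Triple
rotate (i , j , k) = (j , k , i)

≈-refl : ∀ {γ} → γ ≈ γ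
≈-refl = inj₁ refl

≈-sym : ∀ {γ δ} → γ ≈ δ → δ ≈ γ
≈-sym (inj₁ refl)        = inj₁ refl
≈-sym (inj₂ (inj₁ refl)) = inj₂ (inj₂ refl)
≈-sym (inj₂ (inj₂ refl)) = inj₂ (inj₁ refl)

≈-rotate : ∀ {γ δ} → γ ≈ δ → γ ≈ rotate δ
≈-rotate (inj₁ refl)        = inj₂ (inj₁ refl)
≈-rotate (inj₂ (inj₁ refl)) = inj₂ (inj₂ refl)
≈-rotate (inj₂ (inj₂ refl)) = inj₁ refl

rotate-invariant⇒respects-≈ : {P : Triple → Set} → (∀ {γ} → P γ → P (rotate γ)) → P Respects _≈_
rotate-invariant⇒respects-≈ P-rotate (inj₁ refl)        p = p
rotate-invariant⇒respects-≈ P-rotate (inj₂ (inj₁ refl)) p = P-rotate p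
rotate-invariant⇒respects-≈ P-rotate (inj₂ (inj₂ refl)) p = P-rotate (P-rotate p)

≈-trans : ∀ {γ δ ε} → γ ≈ δ → δ ≈ ε → γ ≈ ε
≈-trans γ≈δ δ≈ε = rotate-invariant⇒respects-≈ ≈-rotate δ≈ε γ≈δ

≈-setoid : Setoid _ _
≈-setoid = record
  { Carrier       = Triple
  ; _≈_           = _≈_
  ; isEquivalence = record { refl = ≈-refl ; sym = ≈-sym ; trans = ≈-trans }
  }

open import Relation.Binary.Reasoning.Setoid ≈-setoid

distinct-rotate : ∀ {γ} → Distinct γ → Distinct (rotate γ)
distinct-rotate (i≢j , j≢k , k≢i) = j≢k , k≢i , i≢j

distinct-resp-≈ : Distinct Respects _≈_
distinct-resp-≈ = rotate-invariant⇒respects-≈ distinct-rotate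

rotate-invariant⇒resp-≈ : {f : Triple → Triple} → (∀ {γ} → Distinct γ → f (rotate γ) ≈ f γ) →
                          ∀ {γ δ} → Distinct γ → γ ≈ δ → f γ ≈ f δ
rotate-invariant⇒resp-≈ {f} f-rotate {γ} dγ γ≈δ =
  proj₂ (rotate-invariant⇒respects-≈ step γ≈δ (dγ , ≈-refl))
  where
  step : ∀ {δ} → Distinct δ × f γ ≈ f δ → Distinct (rotate δ) × f γ ≈ f (rotate δ)
  step (dδ , e) = distinct-rotate dδ , ≈-trans e (≈-sym (f-rotate dδ))

_≟₃_ : DecidableEquality Triple
_≟₃_ = ≡-dec _≟_ (≡-dec _≟_ _≟_)

_≈?_ : (γ δ : Triple) → Dec (γ ≈ δ)
(i , j , k) ≈? δ = δ ≟₃ (i , j , k) ⊎-dec δ ≟₃ (j , k , i) ⊎-dec δ ≟₃ (k , i , j)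

distinct? : Decidable Distinct
distinct? (i , j , k) = ¬? (i ≟ j) ×-dec ¬? (j ≟ k) ×-dec ¬? (k ≟ i)

∀-triple? : {P : Triple → Set} → Decidable P → Dec (∀ γ → P γ)
∀-triple? P? = map′ (λ h (i , j , k) → h i j k) (λ h i j k → h (i , j , k))
                    (all? λ i → all? λ j → all? λ k → P? (i , j , k))

cycEq⇒≈ : ∀ γ δ → T (cycEq γ δ) → γ ≈ δ
cycEq⇒≈ = from-yes (∀-triple? λ γ → ∀-triple? λ δ → T? (cycEq γ δ) →-dec γ ≈? δ)

≈⇒cycEq : ∀ γ δ → γ ≈ δ → T (cycEq γ δ)
≈⇒cycEq = from-yes (∀-triple? λ γ → ∀-triple? λ δ → γ ≈? δ →-dec T? (cycEq γ δ))

π-distinct : ∀ p q γ → Distinct γ → Distinct (π p q γ)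
π-distinct = from-yes (all? λ p → all? λ q → ∀-triple? λ γ → distinct? γ →-dec distinct? (π p q γ))

π-rotate : ∀ p q γ → p ≢ q → Distinct γ → π p q (rotate γ) ≈ π p q γ
π-rotate = from-yes (all? λ p → all? λ q → ∀-triple? λ γ →
  ¬? (p ≟ q) →-dec distinct? γ →-dec π p q (rotate γ) ≈? π p q γ)

π-involutive : ∀ p q γ → p ≢ q → Distinct γ → π p q (π p q γ) ≈ γ
π-involutive = from-yes (all? λ p → all? λ q → ∀-triple? λ γ →
  ¬? (p ≟ q) →-dec distinct? γ →-dec π p q (π p q γ) ≈? γ)

π-comm : ∀ p q r s γ → p ≢ q → r ≢ s → Distinct γ → π p q (π r s γ) ≈ π r s (π p q γ)
π-comm = from-yes (all? λ p → all? λ q → all? λ r → all? λ s → ∀-triple? λ γ →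
  ¬? (p ≟ q) →-dec ¬? (r ≟ s) →-dec distinct? γ →-dec π p q (π r s γ) ≈? π r s (π p q γ))

search : {A : Set} → (A → Bool) → A → List A → A
search p d []       = d
search p d (x ∷ xs) = if p x then x else search p d xs

search-finds : {A : Set} (p : A → Bool) (d : A) (xs : List A) →
               Any (T ∘ p) xs → search p d xs ∈ xs × T (p (search p d xs))
search-finds p d (x ∷ xs) any with p x in px | any
... | true  | _          = here refl , subst T (sym px) _
... | false | here found with () ← subst T px found
... | false | there any′ = let (∈xs , found) = search-finds p d xs any′ in there ∈xs , found

∈-allTriples⁺ : ∀ γ → Distinct γ → γ ∈ allTriples
∈-allTriples⁺ = from-yes (∀-triple? λ γ → distinct? γ →-dec Any.any? (γ ≟₃_) allTriples)

allTriples-distinct : All Distinct allTriples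
allTriples-distinct = from-yes (All.all? distinct? allTriples)

Commute : (f g : Triple → Triple) → Set
Commute f g = ∀ {γ} → Distinct γ → f (g γ) ≈ g (f γ)

record CentralInvolution (f : Triple → Triple) : Set where
  field
    distinct   : ∀ {γ} → Distinct γ → Distinct (f γ)
    resp-≈     : ∀ {γ δ} → Distinct γ → γ ≈ δ → f γ ≈ f δ
    involutive : ∀ {γ} → Distinct γ → f (f γ) ≈ γ
    central    : ∀ {p q} → p ≢ q → Commute f (π p q)

π-central : ∀ {p q} → p ≢ q → CentralInvolution (π p q)
π-central {p} {q} p≢q = record
  { distinct   = π-distinct p q _
  ; resp-≈     = rotate-invariant⇒resp-≈ (π-rotate p q _ p≢q)
  ; involutive = π-involutive p q _ p≢q
  ; central    = λ {r} {s} r≢s → π-comm p q r s _ p≢q r≢s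
  }

id-central : CentralInvolution (λ γ → γ)
id-central = record
  { distinct   = λ dγ → dγ
  ; resp-≈     = λ _ γ≈δ → γ≈δ
  ; involutive = λ _ → ≈-refl
  ; central    = λ _ _ → ≈-refl
  }

∘-central : ∀ {f g} → CentralInvolution f → CentralInvolution g → Commute f g →
            CentralInvolution (f ∘ g)
∘-central {f} {g} F G fg≈gf = record
  { distinct   = F.distinct ∘ G.distinct
  ; resp-≈     = λ dγ γ≈δ → F.resp-≈ (G.distinct dγ) (G.resp-≈ dγ γ≈δ)
  ; involutive = involutive
  ; central    = λ {p} {q} p≢q {γ} dγ → begin
      f (g (π p q γ)) ≈⟨ F.resp-≈ (G.distinct (π-distinct p q γ dγ)) (G.central p≢q dγ) ⟩
      f (π p q (g γ)) ≈⟨ F.central p≢q (G.distinct dγ) ⟩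
      π p q (f (g γ)) ∎
  }
  where
  module F = CentralInvolution F
  module G = CentralInvolution G
  involutive : ∀ {γ} → Distinct γ → f (g (f (g γ))) ≈ γ
  involutive {γ} dγ = begin
    f (g (f (g γ))) ≈⟨ F.resp-≈ (F.distinct (G.distinct dgγ)) (fg≈gf dgγ) ⟨
    f (f (g (g γ))) ≈⟨ F.involutive (G.distinct dgγ) ⟩
    g (g γ)         ≈⟨ G.involutive dγ ⟩
    γ               ∎
    where dgγ = G.distinct dγ

central-cong : ∀ {f g} → (∀ {γ} → Distinct γ → g γ ≈ f γ) →
               CentralInvolution f → CentralInvolution g
central-cong {f} {g} g≈f F = record
  { distinct   = distinct
  ; resp-≈     = λ {γ} {δ} dγ γ≈δ → begin
      g γ ≈⟨ g≈f dγ ⟩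
      f γ ≈⟨ F.resp-≈ dγ γ≈δ ⟩
      f δ ≈⟨ g≈f (distinct-resp-≈ γ≈δ dγ) ⟨
      g δ ∎
  ; involutive = λ {γ} dγ → begin
      g (g γ) ≈⟨ g≈f (distinct dγ) ⟩
      f (g γ) ≈⟨ F.resp-≈ (distinct dγ) (g≈f dγ) ⟩
      f (f γ) ≈⟨ F.involutive dγ ⟩
      γ       ∎
  ; central    = λ {p} {q} p≢q {γ} dγ → begin
      g (π p q γ) ≈⟨ g≈f (π-distinct p q γ dγ) ⟩
      f (π p q γ) ≈⟨ F.central p≢q dγ ⟩
      π p q (f γ) ≈⟨ CentralInvolution.resp-≈ (π-central p≢q) (F.distinct dγ) (≈-sym (g≈f dγ)) ⟩
      π p q (g γ) ∎
  }
  where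
  module F = CentralInvolution F
  distinct : ∀ {γ} → Distinct γ → Distinct (g γ)
  distinct dγ = distinct-resp-≈ (≈-sym (g≈f dγ)) (F.distinct dγ)

finv-involution : ∀ {f} → CentralInvolution f → ∀ {γ} → Distinct γ → finv f γ ≈ f γ
finv-involution {f} F {γ} dγ = begin
  finv f γ         ≈⟨ F.involutive dδ ⟨
  f (f (finv f γ)) ≈⟨ F.resp-≈ (F.distinct dδ) (cycEq⇒≈ _ _ (proj₂ found)) ⟩
  f γ              ∎
  where
  module F = CentralInvolution F
  listed-preimage : Any (λ δ → T (cycEq (f δ) γ)) allTriples
  listed-preimage = Any.map (λ { refl → ≈⇒cycEq _ _ (F.involutive dγ) })
                            (∈-allTriples⁺ (f γ) (F.distinct dγ))
  -- finv f γ unfolds to search (λ δ → cycEq (f δ) γ) γ allTriples.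
  found : finv f γ ∈ allTriples × T (cycEq (f (finv f γ)) γ)
  found = search-finds (λ δ → cycEq (f δ) γ) γ allTriples listed-preimage
  dδ : Distinct (finv f γ)
  dδ = All.lookup allTriples-distinct (proj₁ found)

finv-central : ∀ {f} → CentralInvolution f → CentralInvolution (finv f)
finv-central F = central-cong (finv-involution F) F

module Generated {Gen : Fin 4 → Fin 4 → Set} (gen⇒≢ : ∀ {p q} → Gen p q → p ≢ q) where

  mutual
    ⟦⟧-central : (w : Word Gen) → CentralInvolution ⟦ w ⟧
    ⟦⟧-central (gen p q g) = π-central (gen⇒≢ g)
    ⟦⟧-central idw         = id-central
    ⟦⟧-central (w · v)     =
      ∘-central (⟦⟧-central w) (⟦⟧-central v) (central-commutes-⟦⟧ (⟦⟧-central w) v)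
    ⟦⟧-central (inv w)     = finv-central (⟦⟧-central w)

    central-commutes-⟦⟧ : ∀ {f} → CentralInvolution f → (v : Word Gen) → Commute f ⟦ v ⟧
    central-commutes-⟦⟧ F (gen p q g) = CentralInvolution.central F (gen⇒≢ g)
    central-commutes-⟦⟧ F idw         = λ _ → ≈-refl
    central-commutes-⟦⟧ {f} F (w · v) {γ} dγ = begin
      f (⟦ w ⟧ (⟦ v ⟧ γ)) ≈⟨ central-commutes-⟦⟧ F w (V.distinct dγ) ⟩
      ⟦ w ⟧ (f (⟦ v ⟧ γ)) ≈⟨ W.resp-≈ (F.distinct (V.distinct dγ)) (central-commutes-⟦⟧ F v dγ) ⟩
      ⟦ w ⟧ (⟦ v ⟧ (f γ)) ∎
      where
      module F = CentralInvolution F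
      module W = CentralInvolution (⟦⟧-central w)
      module V = CentralInvolution (⟦⟧-central v)
    central-commutes-⟦⟧ {f} F (inv v) {γ} dγ = begin
      f (finv ⟦ v ⟧ γ) ≈⟨ F.resp-≈ (I.distinct dγ) (finv-involution (⟦⟧-central v) dγ) ⟩
      f (⟦ v ⟧ γ)      ≈⟨ central-commutes-⟦⟧ F v dγ ⟩
      ⟦ v ⟧ (f γ)      ≈⟨ finv-involution (⟦⟧-central v) (F.distinct dγ) ⟨
      finv ⟦ v ⟧ (f γ) ∎
      where
      module F = CentralInvolution F
      module I = CentralInvolution (finv-central (⟦⟧-central v))

  ⟦⟧-preserves : (S : Triple → Set) → S Respects _≈_ → (∀ {γ} → S γ → Distinct γ) →
                 (∀ {p q} → Gen p q → ∀ {γ} → S γ → S (π p q γ)) →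
                 (w : Word Gen) → ∀ {γ} → S γ → S (⟦ w ⟧ γ)
  ⟦⟧-preserves S S-resp S⇒distinct S-π = preserves
    where
    preserves : (w : Word Gen) → ∀ {γ} → S γ → S (⟦ w ⟧ γ)
    preserves (gen p q g) = S-π g
    preserves idw         = λ s → s
    preserves (w · v)     = preserves w ∘ preserves v
    preserves (inv w) s   =
      S-resp (≈-sym (finv-involution (⟦⟧-central w) (S⇒distinct s))) (preserves w s)

  transitive-from : ∀ {b} → Distinct b → (∀ δ → Distinct δ → ∃ λ (w : Word Gen) → ⟦ w ⟧ b ≈ δ) →
                    ∀ γ δ → Distinct γ → Distinct δ → ∃ λ (w : Word Gen) → ⟦ w ⟧ γ ≈ δ
  transitive-from {b} db reach γ δ dγ dδ with reach γ dγ | reach δ dδ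
  ... | u , ub≈γ | v , vb≈δ = v · u , (begin
    ⟦ v ⟧ (⟦ u ⟧ γ) ≈⟨ V.resp-≈ (U.distinct dγ) uγ≈b ⟩
    ⟦ v ⟧ b         ≈⟨ vb≈δ ⟩
    δ               ∎)
    where
    module U = CentralInvolution (⟦⟧-central u)
    module V = CentralInvolution (⟦⟧-central v)
    uγ≈b : ⟦ u ⟧ γ ≈ b
    uγ≈b = begin
      ⟦ u ⟧ γ          ≈⟨ U.resp-≈ dγ (≈-sym ub≈γ) ⟩
      ⟦ u ⟧ (⟦ u ⟧ b) ≈⟨ U.involutive db ⟩
      b                ∎

products : ∀ {Gen} → List (Word Gen) → List (Word Gen)
products []       = idw ∷ []
products (g ∷ gs) = products gs ++ map (g ·_) (products gs)

G-generators : List (Word GenG)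
G-generators =
  gen zero (suc zero) (λ ()) ∷ gen zero (suc (suc zero)) (λ ()) ∷ gen (suc zero) (suc (suc zero)) (λ ()) ∷ []

base : Triple
base = zero , suc zero , suc (suc zero)

reachable-from-base : ∀ δ → Distinct δ → Any (λ w → ⟦ w ⟧ base ≈ δ) (products G-generators)
reachable-from-base = from-yes (∀-triple? λ δ → distinct? δ →-dec
  Any.any? (λ w → ⟦ w ⟧ base ≈? δ) (products G-generators))

module G = Generated (λ p≢q → p≢q)

base-distinct : Distinct base
base-distinct = (λ ()) , (λ ()) , (λ ())

G-transitive : ∀ γ δ → Distinct γ → Distinct δ → ∃ λ (w : Word GenG) → ⟦ w ⟧ γ ≈ δ
G-transitive = G.transitive-from base-distinct (λ δ dδ → Any.satisfied (reachable-from-base δ dδ))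

H-generators : (l : Fin 4) → List (Word (GenH l))
H-generators l = map (λ j → gen (punchIn l j) l (punchInᵢ≢i l j , refl)) (allFin 3)

Γ[_] : Triple → Triple → Set
Γ[ s ] δ = Distinct δ × o δ s ≈ s

o-self : ∀ s → Distinct s → o s s ≈ s
o-self = from-yes (∀-triple? λ s → distinct? s →-dec o s s ≈? s)

o-rotate : ∀ s δ → Distinct s → Distinct δ → o (rotate δ) s ≈ o δ s
o-rotate = from-yes (∀-triple? λ s → ∀-triple? λ δ →
  distinct? s →-dec distinct? δ →-dec o (rotate δ) s ≈? o δ s)

Γ-π-closed : ∀ l i j k → Distinct (i , j , k) → i ≢ l → j ≢ l → k ≢ l → ∀ p → p ≢ l →
      ∀ δ → Distinct δ → o δ (i , j , k) ≈ (i , j , k) → o (π p l δ) (i , j , k) ≈ (i , j , k)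
Γ-π-closed = from-yes (all? λ l → all? λ i → all? λ j → all? λ k →
  distinct? (i , j , k) →-dec ¬? (i ≟ l) →-dec ¬? (j ≟ l) →-dec ¬? (k ≟ l) →-dec
  all? λ p → ¬? (p ≟ l) →-dec ∀-triple? λ δ →
  distinct? δ →-dec o δ (i , j , k) ≈? (i , j , k) →-dec o (π p l δ) (i , j , k) ≈? (i , j , k))

Γ-reachable : ∀ l i j k → Distinct (i , j , k) → i ≢ l → j ≢ l → k ≢ l →
             ∀ δ → Distinct δ → o δ (i , j , k) ≈ (i , j , k) →
             Any (λ w → ⟦ w ⟧ (i , j , k) ≈ δ) (products (H-generators l))
Γ-reachable = from-yes (all? λ l → all? λ i → all? λ j → all? λ k →
  distinct? (i , j , k) →-dec ¬? (i ≟ l) →-dec ¬? (j ≟ l) →-dec ¬? (k ≟ l) →-dec ∀-triple? λ δ →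
  distinct? δ →-dec o δ (i , j , k) ≈? (i , j , k) →-dec
  Any.any? (λ w → ⟦ w ⟧ (i , j , k) ≈? δ) (products (H-generators l)))

genH⇒≢ : ∀ {l p q} → GenH l p q → p ≢ q
genH⇒≢ (p≢l , refl) = p≢l

module H (l : Fin 4) = Generated (genH⇒≢ {l})

H-orbit : ∀ l i j k → Distinct (i , j , k) → i ≢ l → j ≢ l → k ≢ l → ∀ δ → Distinct δ →
          (o δ (i , j , k) ≈ (i , j , k)) ⇔ (∃ λ (w : Word (GenH l)) → ⟦ w ⟧ (i , j , k) ≈ δ)
H-orbit l i j k ds i≢l j≢l k≢l δ dδ = mk⇔
  (λ oδ≈s → Any.satisfied (Γ-reachable l i j k ds i≢l j≢l k≢l δ dδ oδ≈s))
  (λ (w , ws≈δ) → proj₂ (Γ-resp-≈ ws≈δ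
     (H.⟦⟧-preserves l Γ[ s ] Γ-resp-≈ proj₁ Γ-gen-closed w (ds , o-self s ds))))
  where
  s = (i , j , k)
  Γ-resp-≈ : Γ[ s ] Respects _≈_
  Γ-resp-≈ = rotate-invariant⇒respects-≈ λ (dγ , e) →
    distinct-rotate dγ , ≈-trans (o-rotate s _ ds dγ) e
  Γ-gen-closed : ∀ {p q} → GenH l p q → ∀ {γ} → Γ[ s ] γ → Γ[ s ] (π p q γ)
  Γ-gen-closed {p} (p≢l , refl) {γ} (dγ , e) =
    π-distinct p l γ dγ , Γ-π-closed l i j k ds i≢l j≢l k≢l p p≢l γ dγ e

proposition4p1 :
    ((w : Word GenG) (γ : Triple) → Distinct γ → ⟦ w ⟧ (⟦ w ⟧ γ) ≈ γ)
    × ((w v : Word GenG) (γ : Triple) → Distinct γ → ⟦ w ⟧ (⟦ v ⟧ γ) ≈ ⟦ v ⟧ (⟦ w ⟧ γ))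
    × ((γ δ : Triple) → Distinct γ → Distinct δ → ∃ λ (w : Word GenG) → ⟦ w ⟧ γ ≈ δ)
    × ((l i j k : Fin 4) → Distinct (i , j , k) → i ≢ l → j ≢ l → k ≢ l →
         ∃ λ γ₀ → Distinct γ₀ × ((δ : Triple) → Distinct δ →
           (o δ (i , j , k) ≈ (i , j , k)) ⇔ (∃ λ (w : Word (GenH l)) → ⟦ w ⟧ γ₀ ≈ δ)))
proposition4p1 =
    (λ w γ → CentralInvolution.involutive (G.⟦⟧-central w))
  , (λ w v γ → G.central-commutes-⟦⟧ (G.⟦⟧-central w) v)
  , G-transitive
  , λ l i j k ds i≢l j≢l k≢l → (i , j , k) , ds , H-orbit l i j k ds i≢l j≢l k≢l
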